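{- Let $G_0$ be a rooted $\ell$-connected directed graph with root $r$ and terminal set $T$, let $\mathcal{F}$ be the family of all deficient sets in $G_0$, and let $C$ be any core of $\mathcal{F}$. Then for any two deficient sets $A,B\in\mathsf{Halo}(C)$, both $A\cap B$ and $A\cup B$ are deficient sets belonging to $\mathsf{Halo}(C)$.
   Context: $G_0$ is rooted $\ell$-connected if it contains $\ell$ edge-disjoint $r\to t$ paths for every $t\in T$ (where $T\subseteq V(G_0)\setminus\{r\}$). $\deg^{in}_{G_0}(U)$ is the number of edges of $G_0$ entering $U$. A deficient set is $U\subseteq V(G_0)$ with $r\notin U$, $U\cap T\ne\emptyset$, $\deg^{in}_{G_0}(U)=\ell$. A core is a member of $\mathcal{F}$ that properly contains no other member of $\mathcal{F}$. For a core $C$, $\mathsf{Halo}(C)$ is the collection of sets in $\mathcal{F}$ that contain $C$ and contain no core other than $C$. -}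

module Defs where

open import Data.Nat using (ℕ)
open import Data.Fin using (Fin)
open import Data.Fin.Subset using (Subset; _∈_; _∉_; _⊆_; _⊂_; _∩_; Nonempty)
open import Data.Fin.Subset.Properties using (_∈?_)
open import Data.List using (List; []; _∷_; length; filter)
open import Data.List.Membership.Propositional using () renaming (_∈_ to _∈ₗ_)
open import Data.List.Base using (allFin)
open import Data.Product using (_×_; Σ)
open import Relation.Nullary using (¬_)
open import Relation.Nullary.Decidable using (_×-dec_; ¬?)
open import Relation.Binary.PropositionalEquality using (_≡_)

record Digraph : Set where
  field
    n  : ℕ
    m  : ℕ
    tl : Fin m → Fin n
    hd : Fin m → Fin n
open Digraph public

data Walk (G : Digraph) : Fin (n G) → Fin (n G) → Set where
  nil  : ∀ {v} → Walk G v v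
  cons : ∀ {u w} (e : Fin (m G)) → tl G e ≡ u → Walk G (hd G e) w → Walk G u w

edgesOf : ∀ {G u w} → Walk G u w → List (Fin (m G))
edgesOf nil            = []
edgesOf (cons e _ p)   = e ∷ edgesOf p

verticesOf : ∀ {G u w} → Walk G u w → List (Fin (n G))
verticesOf {u = u} nil = u ∷ []
verticesOf {u = u} (cons e _ p) = u ∷ verticesOf p

open import Data.List.Relation.Unary.Unique.Propositional using (Unique)

IsPath : ∀ {G u w} → Walk G u w → Set
IsPath p = Unique (verticesOf p)

-- ℓ pairwise edge-disjoint u→w paths (each path also uses no edge twice,
-- which is automatic for a vertex-simple path).
EdgeDisjointPaths : (G : Digraph) → ℕ → Fin (n G) → Fin (n G) → Set
EdgeDisjointPaths G ℓ u w =
  Σ (Fin ℓ → Walk G u w) λ P →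
    ((i : Fin ℓ) → IsPath (P i)) ×
    ((i j : Fin ℓ) (e : Fin (m G)) → e ∈ₗ edgesOf (P i) → e ∈ₗ edgesOf (P j) → i ≡ j)

RootedConnected : (G : Digraph) → ℕ → Fin (n G) → Subset (n G) → Set
RootedConnected G ℓ r T = (t : Fin (n G)) → t ∈ T → EdgeDisjointPaths G ℓ r t

degIn : (G : Digraph) → Subset (n G) → ℕ
degIn G U = length (filter (λ e → ¬? (tl G e ∈? U) ×-dec (hd G e ∈? U)) (allFin (m G)))

Deficient : (G : Digraph) → ℕ → Fin (n G) → Subset (n G) → Subset (n G) → Set
Deficient G ℓ r T U = (r ∉ U) × Nonempty (U ∩ T) × (degIn G U ≡ ℓ)

IsCore : ∀ {k} → (Subset k → Set) → Subset k → Set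
IsCore {k} F C = F C × ((D : Subset k) → F D → ¬ (D ⊂ C))

InHalo : ∀ {k} → (Subset k → Set) → Subset k → Subset k → Set
InHalo {k} F C X = F X × (C ⊆ X) × ((C' : Subset k) → IsCore F C' → C' ⊆ X → C' ≡ C)

-- Each of the ℓ edge-disjoint paths from r to a terminal t ∈ U, where r ∉ U, enters U, so
-- degIn ≥ ℓ on every set that avoids r and contains a terminal. Together with submodularity
-- of degIn this uncrosses deficient sets: if A and B share a terminal, then
-- ℓ + ℓ ≤ degIn (A ∩ B) + degIn (A ∪ B) ≤ degIn A + degIn B = ℓ + ℓ, so A ∩ B and A ∪ B are
-- deficient too. Uncrossing a core against a deficient set sharing one of its terminals
-- shows, by minimality, that the core lies inside that set; hence a core inside A ∪ B lies
-- inside A or B, which keeps A ∪ B (and trivially A ∩ B) in the halo.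
module Submission where

open import Defs
open import Data.Nat using (ℕ; _+_; _≤_; _≤?_; z≤n)
open import Data.Nat.Properties
  using (≤-antisym; ≤-trans; ≤-reflexive; +-mono-≤; +-monoʳ-≤; +-cancelʳ-≤; +-comm; +-commutativeSemigroup)
open import Data.Bool using (Bool; true; false; not; _∧_; _∨_)
open import Data.Fin using (Fin; zero; suc)
open import Data.Fin.Properties using (injective⇒≤)
open import Data.Fin.Subset using (Subset; Nonempty; _∈_; _∉_; _⊆_; _∩_; _∪_; inside; outside)
open import Data.Fin.Subset.Properties using (_∈?_; x∈p∩q⁺; x∈p∩q⁻; x∈p∪q⁺; x∈p∪q⁻; p∩q⊆p; p∩q⊆q)
open import Data.Vec using (_∷_; lookup)
open import Data.Vec.Properties using (lookup-zipWith)
open import Data.List using (List; []; _∷_; length; filter) renaming (lookup to lookupₗ)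
open import Data.List.Base using (allFin)
open import Data.List.Membership.Propositional using () renaming (_∈_ to _∈ₗ_)
open import Data.List.Membership.Propositional.Properties using (∈-filter⁺; ∈-allFin)
open import Data.List.Relation.Unary.Any using (here; there; index)
open import Data.List.Relation.Unary.Any.Properties using (lookup-index)
open import Data.Product using (_×_; _,_; proj₁; proj₂; ∃)
open import Data.Sum using (_⊎_; inj₁; inj₂; [_,_]′)
open import Data.Empty using (⊥-elim)
open import Relation.Nullary using (yes; no; does)
open import Relation.Nullary.Decidable using (True; toWitness; ¬?; _×-dec_)
open import Relation.Unary using (Decidable)
open import Relation.Binary.PropositionalEquality using (_≡_; refl; sym; trans; cong; cong₂; subst)
open import Algebra.Properties.CommutativeSemigroup +-commutativeSemigroup using (interchange)

private
  variable
    A : Set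

indicator : Bool → ℕ
indicator true  = 1
indicator false = 0

length-filter-∷ : ∀ {P : A → Set} (P? : Decidable P) x xs →
                  length (filter P? (x ∷ xs)) ≡ indicator (does (P? x)) + length (filter P? xs)
length-filter-∷ P? x xs with does (P? x)
... | true  = refl
... | false = refl

length-filter-submodular :
  ∀ {P Q R S : A → Set} (P? : Decidable P) (Q? : Decidable Q) (R? : Decidable R) (S? : Decidable S) →
  (∀ x → indicator (does (P? x)) + indicator (does (Q? x)) ≤ indicator (does (R? x)) + indicator (does (S? x))) →
  ∀ xs → length (filter P? xs) + length (filter Q? xs) ≤ length (filter R? xs) + length (filter S? xs)
length-filter-submodular P? Q? R? S? pointwise [] = z≤n
length-filter-submodular P? Q? R? S? pointwise (x ∷ xs)
  rewrite length-filter-∷ P? x xs | length-filter-∷ Q? x xs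
        | length-filter-∷ R? x xs | length-filter-∷ S? x xs
        | interchange (indicator (does (P? x))) (length (filter P? xs))
                      (indicator (does (Q? x))) (length (filter Q? xs))
        | interchange (indicator (does (R? x))) (length (filter R? xs))
                      (indicator (does (S? x))) (length (filter S? xs))
  = +-mono-≤ (pointwise x) (length-filter-submodular P? Q? R? S? pointwise xs)

injection-into-list⇒≤ : ∀ {ℓ} (xs : List A) (f : Fin ℓ → A) → (∀ i → f i ∈ₗ xs) →
                        (∀ i j → f i ≡ f j → i ≡ j) → ℓ ≤ length xs
injection-into-list⇒≤ xs f f∈xs f-injective = injective⇒≤ position-injective
  where
  position-injective : ∀ {i j} → index (f∈xs i) ≡ index (f∈xs j) → i ≡ j
  position-injective {i} {j} eq = f-injective i j
    (trans (lookup-index (f∈xs i)) (trans (cong (lookupₗ xs) eq) (sym (lookup-index (f∈xs j)))))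

≤-squeeze : ∀ {ℓ x y} → ℓ ≤ x → ℓ ≤ y → x + y ≤ ℓ + ℓ → x ≡ ℓ
≤-squeeze {ℓ} {x} ℓ≤x ℓ≤y x+y≤ℓ+ℓ = ≤-antisym (+-cancelʳ-≤ ℓ x ℓ (≤-trans (+-monoʳ-≤ x ℓ≤y) x+y≤ℓ+ℓ)) ℓ≤x

does-∈? : ∀ {k} (x : Fin k) (p : Subset k) → does (x ∈? p) ≡ lookup p x
does-∈? zero    (inside  ∷ p) = refl
does-∈? zero    (outside ∷ p) = refl
does-∈? (suc x) (_ ∷ p)       = does-∈? x p

Entering : (G : Digraph) → Subset (n G) → Fin (m G) → Set
Entering G U e = tl G e ∉ U × hd G e ∈ U

-- Definitionally the predicate that degIn filters by.
entering? : (G : Digraph) (U : Subset (n G)) → Decidable (Entering G U)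
entering? G U e = ¬? (tl G e ∈? U) ×-dec (hd G e ∈? U)

enters : Bool → Bool → Bool
enters tail∈ head∈ = not tail∈ ∧ head∈

≤-by-evaluation : ∀ {x y} {x≤y : True (x ≤? y)} → x ≤ y
≤-by-evaluation {x≤y = x≤y} = toWitness x≤y

enters-submodular : ∀ a a′ b b′ →
  indicator (enters (a ∧ b) (a′ ∧ b′)) + indicator (enters (a ∨ b) (a′ ∨ b′)) ≤
  indicator (enters a a′) + indicator (enters b b′)
enters-submodular true  true  true  true  = ≤-by-evaluation
enters-submodular true  true  true  false = ≤-by-evaluation
enters-submodular true  true  false true  = ≤-by-evaluation
enters-submodular true  true  false false = ≤-by-evaluation
enters-submodular true  false true  true  = ≤-by-evaluation
enters-submodular true  false true  false = ≤-by-evaluation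
enters-submodular true  false false true  = ≤-by-evaluation
enters-submodular true  false false false = ≤-by-evaluation
enters-submodular false true  true  true  = ≤-by-evaluation
enters-submodular false true  true  false = ≤-by-evaluation
enters-submodular false true  false true  = ≤-by-evaluation
enters-submodular false true  false false = ≤-by-evaluation
enters-submodular false false true  true  = ≤-by-evaluation
enters-submodular false false true  false = ≤-by-evaluation
enters-submodular false false false true  = ≤-by-evaluation
enters-submodular false false false false = ≤-by-evaluation

degIn-submodular : ∀ G (X Y : Subset (n G)) → degIn G (X ∩ Y) + degIn G (X ∪ Y) ≤ degIn G X + degIn G Y
degIn-submodular G X Y =
  length-filter-submodular (entering? G (X ∩ Y)) (entering? G (X ∪ Y)) (entering? G X) (entering? G Y)
                           pointwise (allFin (m G))
  where
  pointwise : ∀ e → indicator (does (entering? G (X ∩ Y) e)) + indicator (does (entering? G (X ∪ Y) e)) ≤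
                    indicator (does (entering? G X e)) + indicator (does (entering? G Y e))
  pointwise e
    rewrite does-∈? (tl G e) (X ∩ Y) | does-∈? (hd G e) (X ∩ Y)
          | does-∈? (tl G e) (X ∪ Y) | does-∈? (hd G e) (X ∪ Y)
          | does-∈? (tl G e) X | does-∈? (hd G e) X | does-∈? (tl G e) Y | does-∈? (hd G e) Y
          | lookup-zipWith _∧_ (tl G e) X Y | lookup-zipWith _∧_ (hd G e) X Y
          | lookup-zipWith _∨_ (tl G e) X Y | lookup-zipWith _∨_ (hd G e) X Y
    = enters-submodular (lookup X (tl G e)) (lookup X (hd G e)) (lookup Y (tl G e)) (lookup Y (hd G e))

walk-enters : ∀ {G} (U : Subset (n G)) {u w} (p : Walk G u w) → u ∉ U → w ∈ U →
              ∃ λ e → e ∈ₗ edgesOf p × Entering G U e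
walk-enters U nil u∉U w∈U = ⊥-elim (u∉U w∈U)
walk-enters {G} U (cons e refl p) u∉U w∈U with hd G e ∈? U
... | yes hd∈U = e , here refl , u∉U , hd∈U
... | no  hd∉U with walk-enters U p hd∉U w∈U
...   | e′ , e′∈p , enters = e′ , there e′∈p , enters

degIn-≥ : ∀ {G ℓ r T} → RootedConnected G ℓ r T →
          ∀ {U t} → r ∉ U → t ∈ U → t ∈ T → ℓ ≤ degIn G U
degIn-≥ {G} {ℓ} {r} connected {U} {t} r∉U t∈U t∈T
  with paths , _ , edge-disjoint ← connected t t∈T
  = injection-into-list⇒≤ _ crossing crossing-enters crossing-injective
  where
  crossing-of : ∀ i → ∃ λ e → e ∈ₗ edgesOf (paths i) × Entering G U e
  crossing-of i = walk-enters U (paths i) r∉U t∈U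

  crossing : Fin ℓ → Fin (m G)
  crossing i = proj₁ (crossing-of i)

  crossing-enters : ∀ i → crossing i ∈ₗ filter (entering? G U) (allFin (m G))
  crossing-enters i = ∈-filter⁺ (entering? G U) (∈-allFin (crossing i)) (proj₂ (proj₂ (crossing-of i)))

  crossing-injective : ∀ i j → crossing i ≡ crossing j → i ≡ j
  crossing-injective i j eq = edge-disjoint i j (crossing j)
    (subst (_∈ₗ edgesOf (paths i)) eq (proj₁ (proj₂ (crossing-of i))))
    (proj₁ (proj₂ (crossing-of j)))

deficient-∩-∪ : ∀ {G ℓ r T} → RootedConnected G ℓ r T → ∀ {X Y} →
                Deficient G ℓ r T X → Deficient G ℓ r T Y → Nonempty ((X ∩ Y) ∩ T) →
                Deficient G ℓ r T (X ∩ Y) × Deficient G ℓ r T (X ∪ Y)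
deficient-∩-∪ {G} {ℓ} {r} {T} connected {X} {Y} (r∉X , _ , X-tight) (r∉Y , _ , Y-tight) (t , t∈X∩Y∩T) =
  (r∉X∩Y , (t , t∈X∩Y∩T) , ∩-tight) , (r∉X∪Y , (t , x∈p∩q⁺ (t∈X∪Y , t∈T)) , ∪-tight)
  where
  t∈X∩Y : t ∈ X ∩ Y
  t∈X∩Y = p∩q⊆p (X ∩ Y) T t∈X∩Y∩T

  t∈T : t ∈ T
  t∈T = proj₂ (x∈p∩q⁻ (X ∩ Y) T t∈X∩Y∩T)

  t∈X∪Y : t ∈ X ∪ Y
  t∈X∪Y = x∈p∪q⁺ (inj₁ (p∩q⊆p X Y t∈X∩Y))

  r∉X∩Y : r ∉ X ∩ Y
  r∉X∩Y r∈X∩Y = r∉X (p∩q⊆p X Y r∈X∩Y)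

  r∉X∪Y : r ∉ X ∪ Y
  r∉X∪Y r∈X∪Y with x∈p∪q⁻ X Y r∈X∪Y
  ... | inj₁ r∈X = r∉X r∈X
  ... | inj₂ r∈Y = r∉Y r∈Y

  ℓ≤∩ : ℓ ≤ degIn G (X ∩ Y)
  ℓ≤∩ = degIn-≥ connected r∉X∩Y t∈X∩Y t∈T

  ℓ≤∪ : ℓ ≤ degIn G (X ∪ Y)
  ℓ≤∪ = degIn-≥ connected r∉X∪Y t∈X∪Y t∈T

  ∩+∪≤ℓ+ℓ : degIn G (X ∩ Y) + degIn G (X ∪ Y) ≤ ℓ + ℓ
  ∩+∪≤ℓ+ℓ = ≤-trans (degIn-submodular G X Y) (≤-reflexive (cong₂ _+_ X-tight Y-tight))

  ∩-tight : degIn G (X ∩ Y) ≡ ℓ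
  ∩-tight = ≤-squeeze ℓ≤∩ ℓ≤∪ ∩+∪≤ℓ+ℓ

  ∪-tight : degIn G (X ∪ Y) ≡ ℓ
  ∪-tight = ≤-squeeze ℓ≤∪ ℓ≤∩ (subst (_≤ ℓ + ℓ) (+-comm (degIn G (X ∩ Y)) _) ∩+∪≤ℓ+ℓ)

core-⊆-deficient : ∀ {G ℓ r T} → RootedConnected G ℓ r T → ∀ {C X} →
                   IsCore (Deficient G ℓ r T) C → Deficient G ℓ r T X → Nonempty ((C ∩ X) ∩ T) → C ⊆ X
core-⊆-deficient connected {C} {X} (C-deficient , C-minimal) X-deficient shared {x} x∈C with x ∈? X
... | yes x∈X = x∈X
... | no  x∉X = ⊥-elim (C-minimal (C ∩ X) (proj₁ (deficient-∩-∪ connected C-deficient X-deficient shared))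
                          (p∩q⊆p C X , x , x∈C , λ x∈C∩X → x∉X (p∩q⊆q C X x∈C∩X)))

core-⊆-∪-deficient : ∀ {G ℓ r T} → RootedConnected G ℓ r T → ∀ {C X Y} →
                     IsCore (Deficient G ℓ r T) C → Deficient G ℓ r T X → Deficient G ℓ r T Y →
                     C ⊆ X ∪ Y → C ⊆ X ⊎ C ⊆ Y
core-⊆-∪-deficient {T = T} connected {C} {X} {Y} C-core@((_ , (t , t∈C∩T) , _) , _) X-deficient Y-deficient C⊆X∪Y
  with t∈C , t∈T ← x∈p∩q⁻ C T t∈C∩T
  with x∈p∪q⁻ X Y (C⊆X∪Y t∈C)
... | inj₁ t∈X = inj₁ (core-⊆-deficient connected C-core X-deficient (t , x∈p∩q⁺ (x∈p∩q⁺ (t∈C , t∈X) , t∈T)))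
... | inj₂ t∈Y = inj₂ (core-⊆-deficient connected C-core Y-deficient (t , x∈p∩q⁺ (x∈p∩q⁺ (t∈C , t∈Y) , t∈T)))

halo-∩ : ∀ {k} {F : Subset k → Set} {C X Y} → InHalo F C X → InHalo F C Y → F (X ∩ Y) → InHalo F C (X ∩ Y)
halo-∩ {X = X} {Y} (_ , C⊆X , X-cores) (_ , C⊆Y , _) F-X∩Y =
  F-X∩Y , (λ x∈C → x∈p∩q⁺ (C⊆X x∈C , C⊆Y x∈C)) , λ C′ C′-core C′⊆X∩Y → X-cores C′ C′-core (λ x∈C′ → p∩q⊆p X Y (C′⊆X∩Y x∈C′))

halo-∪ : ∀ {k} {F : Subset k → Set} {C X Y} →
         (∀ C′ → IsCore F C′ → C′ ⊆ X ∪ Y → C′ ⊆ X ⊎ C′ ⊆ Y) →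
         InHalo F C X → InHalo F C Y → F (X ∪ Y) → InHalo F C (X ∪ Y)
halo-∪ split (_ , C⊆X , X-cores) (_ , _ , Y-cores) F-X∪Y =
  F-X∪Y , (λ x∈C → x∈p∪q⁺ (inj₁ (C⊆X x∈C))) , λ C′ C′-core C′⊆X∪Y →
    [ X-cores C′ C′-core , Y-cores C′ C′-core ]′ (split C′ C′-core C′⊆X∪Y)

lemma5 : (G : Digraph) (ℓ : ℕ) (r : Fin (n G)) (T : Subset (n G)) →
    r ∉ T → RootedConnected G ℓ r T →
    (C : Subset (n G)) → IsCore (Deficient G ℓ r T) C →
    (A B : Subset (n G)) →
    InHalo (Deficient G ℓ r T) C A → InHalo (Deficient G ℓ r T) C B →
    (Deficient G ℓ r T (A ∩ B) × InHalo (Deficient G ℓ r T) C (A ∩ B)) ×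
    (Deficient G ℓ r T (A ∪ B) × InHalo (Deficient G ℓ r T) C (A ∪ B))
lemma5 G ℓ r T _ connected C ((_ , (t , t∈C∩T) , _) , _) A B
       A-halo@(A-deficient , C⊆A , _) B-halo@(B-deficient , C⊆B , _) =
  (∩-deficient , halo-∩ A-halo B-halo ∩-deficient) ,
  (∪-deficient , halo-∪ split A-halo B-halo ∪-deficient)
  where
  t∈C : t ∈ C
  t∈C = p∩q⊆p C T t∈C∩T

  shared-terminal : Nonempty ((A ∩ B) ∩ T)
  shared-terminal = t , x∈p∩q⁺ (x∈p∩q⁺ (C⊆A t∈C , C⊆B t∈C) , p∩q⊆q C T t∈C∩T)

  ∩-deficient : Deficient G ℓ r T (A ∩ B)
  ∩-deficient = proj₁ (deficient-∩-∪ connected A-deficient B-deficient shared-terminal)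
  ∪-deficient : Deficient G ℓ r T (A ∪ B)
  ∪-deficient = proj₂ (deficient-∩-∪ connected A-deficient B-deficient shared-terminal)

  split : ∀ C′ → IsCore (Deficient G ℓ r T) C′ → C′ ⊆ A ∪ B → C′ ⊆ A ⊎ C′ ⊆ B
  split C′ C′-core = core-⊆-∪-deficient connected C′-core A-deficient B-deficient
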